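{- Let $n$ and $k$ be positive integers with $k\leq n$. For every positive integer $q\leq\frac{n}{2k+1}$ such that all divisors of $q$ other than $1$ are greater than $k$, \[ f_k(n)\leq (2k+1)f_k\!\left(\left\lfloor\frac{n}{2k+1}\right\rfloor\right)+2n(n-q(2k+1))+\frac{n^2}{2k+1}+k\sum_{d=0}^{q-1}\gcd((2k+1)d,q). \]
   Context: Let $k$ be a positive integer and $A$ a finite set (alphabet). A sequence $x_1,\ldots,x_m$ of elements of $A$ is a $k$-radius sequence over $A$ if for every $a,b\in A$ there are indices $i,j\in\{1,\ldots,m\}$ with $x_i=a$, $x_j=b$ and $|i-j|\leq k$. $f_k(m)$ denotes the length of a shortest $k$-radius sequence over an $m$-element alphabet (for any positive integer $m$). $\gcd(0,q)=q$. -}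

module Defs where

open import Data.Nat using (ℕ; _≤_; ∣_-_∣)
open import Data.Fin using (Fin; toℕ)
open import Data.List using (List; length; lookup)
open import Data.Product using (Σ; _×_)
open import Relation.Binary.PropositionalEquality using (_≡_)

IsKRadius : (k m : ℕ) → List (Fin m) → Set
IsKRadius k m xs =
  (a b : Fin m) →
  Σ (Fin (length xs)) λ i → Σ (Fin (length xs)) λ j →
    (lookup xs i ≡ a) × (lookup xs j ≡ b) × (∣ toℕ i - toℕ j ∣ ≤ k)

-- "L = f_k(m)": L is the length of a shortest k-radius sequence over an
-- m-element alphabet.
IsFk : (k m L : ℕ) → Set
IsFk k m L =
  (Σ (List (Fin m)) λ xs → IsKRadius k m xs × (length xs ≡ L)) ×
  ((xs : List (Fin m)) → IsKRadius k m xs → L ≤ length xs)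

module Submission where

-- Write M = 2k+1 and N = qM, and identify the alphabet with {0, …, n-1}.  Every
-- letter x < N is written uniquely as x = i + M·a with residue i < M and level a < q.
-- We exhibit a k-radius sequence over {0, …, n-1} as the concatenation of
--   * the groups: for every residue i a shortest k-radius sequence over n/M ≥ q
--     letters, relabelled by a ↦ i + M·(a mod q); they cover all pairs of letters
--     below N with equal residues;
--   * the cross blocks: for σ < q and ρ < gcd(Mσ, q) the block of length
--     M·q/gcd(Mσ, q) + k whose entry at position u is (u mod M) + M·((σu + ρ) mod q).
--     As every divisor d ≠ 1 of q exceeds k, each shift 1 ≤ j ≤ k is invertible
--     modulo q, and a Bézout argument shows that they cover all pairs of letters
--     below N with different residues;
--   * for every x ≥ N and every y < n, the two-letter word x y.
-- This sequence has length M·f_k(n/M) + q²M + k·Σ_{σ<q} gcd(Mσ, q) + 2n(n-N), which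
-- bounds f_k(n); multiplying by M and using N² ≤ n² gives the statement.

open import Defs
open import Data.Nat using (ℕ; zero; suc; _+_; _*_; _∸_; _≤_; _<_; _/_; _%_; ∣_-_∣; NonZero; z≤n; s≤s; >-nonZero; ≢-nonZero; ≢-nonZero⁻¹; >-nonZero⁻¹; _≟_; _<?_; _≤?_)
open import Data.Nat.Properties
open import Data.Nat.DivMod
open import Data.Nat.Divisibility using (_∣_; ∣⇒≤)
open import Data.Nat.GCD using (gcd; gcd-GCD; gcd[m,n]∣m; gcd[m,n]∣n; gcd[m,n]≢0; module Bézout)
open import Data.Nat.ListAction using (sum)
open import Data.Nat.Tactic.RingSolver using (solve-∀)
open import Data.Fin using (Fin; toℕ; fromℕ<; cast)
open import Data.Fin.Properties using (toℕ-fromℕ<; toℕ<n; toℕ-injective; toℕ-cast)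
open import Data.List using (List; []; _∷_; map; upTo; length; lookup; foldr; tabulate)
open import Data.List.Properties using (length-upTo; length-tabulate; lookup-tabulate)
open import Data.List.Membership.Propositional using (_∈_)
open import Data.List.Membership.Propositional.Properties using (∈-upTo⁺)
open import Data.List.Relation.Unary.Any using (here; there)
open import Data.Product using (Σ; _×_; _,_; proj₁; proj₂)
open import Data.Sum using (_⊎_; inj₁; inj₂)
open import Relation.Binary.PropositionalEquality
open import Relation.Binary.Definitions using (tri<; tri≈; tri>)
import Relation.Binary.Construct.On as On
import Relation.Binary.Reasoning.Setoid as SetoidReasoning
open import Relation.Nullary using (yes; no)
open import Relation.Nullary.Negation using (contradiction)

-- A finite sequence: a length and its entries (entries at positions ≥ len are
-- irrelevant).  Functions make concatenation and relabelling easy to reason about.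
record Seq : Set where
  constructor mkSeq
  field
    len : ℕ
    at  : ℕ → ℕ
open Seq

Covers : ℕ → Seq → ℕ → ℕ → Set
Covers k s a b = Σ ℕ λ t → Σ ℕ λ u →
  t < len s × u < len s × at s t ≡ a × at s u ≡ b × ∣ t - u ∣ ≤ k

covers-sym : ∀ {k s a b} → Covers k s a b → Covers k s b a
covers-sym (t , u , t< , u< , ta , ub , close) =
  u , t , u< , t< , ub , ta , subst (_≤ _) (∣-∣-comm t u) close

splice : ℕ → (ℕ → ℕ) → (ℕ → ℕ) → ℕ → ℕ
splice L f f' t with t <? L
... | yes _ = f t
... | no _  = f' (t ∸ L)

splice-left : ∀ L f f' {t} → t < L → splice L f f' t ≡ f t
splice-left L f f' {t} t<L with t <? L
... | yes _   = refl
... | no t≮L = contradiction t<L t≮L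

splice-right : ∀ L f f' u → splice L f f' (L + u) ≡ f' u
splice-right L f f' u with (L + u) <? L
... | yes L+u<L = contradiction L+u<L (m+n≮m L u)
... | no _      = cong f' (m+n∸m≡n L u)

infixr 5 _++ˢ_
_++ˢ_ : Seq → Seq → Seq
s ++ˢ s' = mkSeq (len s + len s') (splice (len s) (at s) (at s'))

covers-++ˡ : ∀ {k s a b} s' → Covers k s a b → Covers k (s ++ˢ s') a b
covers-++ˡ {s = s} s' (t , u , t< , u< , ta , ub , close) =
  t , u , ≤-trans t< (m≤m+n _ _) , ≤-trans u< (m≤m+n _ _) ,
  trans (splice-left (len s) (at s) (at s') t<) ta ,
  trans (splice-left (len s) (at s) (at s') u<) ub , close

covers-++ʳ : ∀ {k s' a b} s → Covers k s' a b → Covers k (s ++ˢ s') a b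
covers-++ʳ {k} {s'} s (t , u , t< , u< , ta , ub , close) =
  len s + t , len s + u , +-monoʳ-< (len s) t< , +-monoʳ-< (len s) u< ,
  trans (splice-right (len s) (at s) (at s') t) ta ,
  trans (splice-right (len s) (at s) (at s') u) ub ,
  subst (_≤ k) (sym (∣m+n-m+o∣≡∣n-o∣ (len s) t u)) close

concatˢ : List Seq → Seq
concatˢ = foldr _++ˢ_ (mkSeq 0 (λ _ → 0))

blocks : ℕ → (ℕ → Seq) → Seq
blocks r h = concatˢ (map h (upTo r))

covers-concat : ∀ {k a b} (h : ℕ → Seq) {i} xs → i ∈ xs →
                Covers k (h i) a b → Covers k (concatˢ (map h xs)) a b
covers-concat h (x ∷ xs) (here refl) c = covers-++ˡ (concatˢ (map h xs)) c
covers-concat h (x ∷ xs) (there i∈xs) c = covers-++ʳ (h x) (covers-concat h xs i∈xs c)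

covers-blocks : ∀ {k a b} r (h : ℕ → Seq) {i} → i < r →
                Covers k (h i) a b → Covers k (blocks r h) a b
covers-blocks r h i<r = covers-concat h (upTo r) (∈-upTo⁺ i<r)

len-concat : ∀ (h : ℕ → Seq) (f : ℕ → ℕ) xs → (∀ x → len (h x) ≡ f x) →
             len (concatˢ (map h xs)) ≡ sum (map f xs)
len-concat h f []       _   = refl
len-concat h f (x ∷ xs) len≡ = cong₂ _+_ (len≡ x) (len-concat h f xs len≡)

sum-const : ∀ c (xs : List ℕ) → sum (map (λ _ → c) xs) ≡ length xs * c
sum-const c []       = refl
sum-const c (x ∷ xs) = cong (c +_) (sum-const c xs)

sum-affine : ∀ c k (f : ℕ → ℕ) xs →
             sum (map (λ x → c + k * f x) xs) ≡ length xs * c + k * sum (map f xs)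
sum-affine c k f []       = sym (*-zeroʳ k)
sum-affine c k f (x ∷ xs) =
  trans (cong (c + k * f x +_) (sum-affine c k f xs))
        (regroup c (f x) (length xs) k (sum (map f xs)))
  where
  regroup : ∀ c a L k s → (c + k * a) + (L * c + k * s) ≡ (c + L * c) + k * (a + s)
  regroup = solve-∀

len-blocks : ∀ r (h : ℕ → Seq) c → (∀ x → len (h x) ≡ c) → len (blocks r h) ≡ r * c
len-blocks r h c len≡ =
  trans (len-concat h (λ _ → c) (upTo r) len≡)
        (trans (sum-const c (upTo r)) (cong (_* c) (length-upTo r)))

relabel : (ℕ → ℕ) → Seq → Seq
relabel f s = mkSeq (len s) (λ t → f (at s t))

covers-relabel : ∀ {k s a b} f → Covers k s a b → Covers k (relabel f s) (f a) (f b)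
covers-relabel f (t , u , t< , u< , ta , ub , close) =
  t , u , t< , u< , cong f ta , cong f ub , close

nth : ∀ {m} → List (Fin m) → ℕ → ℕ
nth []       _       = 0
nth (x ∷ xs) zero    = toℕ x
nth (x ∷ xs) (suc t) = nth xs t

nth-lookup : ∀ {m} (xs : List (Fin m)) i → nth xs (toℕ i) ≡ toℕ (lookup xs i)
nth-lookup (x ∷ xs) Fin.zero    = refl
nth-lookup (x ∷ xs) (Fin.suc i) = nth-lookup xs i

fromList : ∀ {m} → List (Fin m) → Seq
fromList xs = mkSeq (length xs) (nth xs)

covers-fromList : ∀ {k m} (xs : List (Fin m)) → IsKRadius k m xs →
                  (a b : Fin m) → Covers k (fromList xs) (toℕ a) (toℕ b)
covers-fromList xs radius a b with radius a b
... | i , j , ia , jb , close =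
  toℕ i , toℕ j , toℕ<n i , toℕ<n j ,
  trans (nth-lookup xs i) (cong toℕ ia) , trans (nth-lookup xs j) (cong toℕ jb) , close

pair : ℕ → ℕ → Seq
pair x y = mkSeq 2 λ { zero → x ; (suc _) → y }

covers-pair : ∀ {k} x y → 1 ≤ k → Covers k (pair x y) x y
covers-pair x y 1≤k = 0 , 1 , s≤s z≤n , s≤s (s≤s z≤n) , refl , refl , 1≤k

module ToWord (n : ℕ) .{{_ : NonZero n}} where

  letter : ℕ → Fin n
  letter x = fromℕ< (m%n<n x n)

  letter-toℕ : (a : Fin n) → letter (toℕ a) ≡ a
  letter-toℕ a = toℕ-injective (trans (toℕ-fromℕ< _) (m<n⇒m%n≡m (toℕ<n a)))

  toWord : Seq → List (Fin n)
  toWord s = tabulate {n = len s} (λ i → letter (at s (toℕ i)))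

  length-toWord : ∀ s → length (toWord s) ≡ len s
  length-toWord s = length-tabulate _

  index : ∀ s {t} → t < len s →
          Σ (Fin (length (toWord s))) λ i → toℕ i ≡ t × lookup (toWord s) i ≡ letter (at s t)
  index s {t} t< =
    cast (sym (length-tabulate _)) (fromℕ< t<) ,
    trans (toℕ-cast _ (fromℕ< t<)) (toℕ-fromℕ< t<) ,
    trans (lookup-tabulate _ (fromℕ< t<)) (cong (λ u → letter (at s u)) (toℕ-fromℕ< t<))

  toWord-isKRadius : ∀ k s → (∀ (a b : Fin n) → Covers k s (toℕ a) (toℕ b)) →
                     IsKRadius k n (toWord s)
  toWord-isKRadius k s cov a b with cov a b
  ... | t , u , t< , u< , ta , ub , close with index s t< | index s u<
  ...   | i , i≡t , i-letter | j , j≡u , j-letter =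
    i , j ,
    trans i-letter (trans (cong letter ta) (letter-toℕ a)) ,
    trans j-letter (trans (cong letter ub) (letter-toℕ b)) ,
    subst (_≤ k) (sym (cong₂ ∣_-_∣ i≡t j≡u)) close

module Modular (q : ℕ) .{{_ : NonZero q}} where

  infix 4 _≈_
  _≈_ : ℕ → ℕ → Set
  a ≈ b = a % q ≡ b % q

  module ≈-Reasoning = SetoidReasoning (On.setoid (setoid ℕ) (_% q))

  ≈-+ : ∀ {a a' b b'} → a ≈ a' → b ≈ b' → a + b ≈ a' + b'
  ≈-+ {a} {a'} {b} {b'} a≈ b≈ =
    trans (%-distribˡ-+ a b q)
          (trans (cong₂ (λ x y → (x + y) % q) a≈ b≈) (sym (%-distribˡ-+ a' b' q)))

  ≈-* : ∀ {a a' b b'} → a ≈ a' → b ≈ b' → a * b ≈ a' * b'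
  ≈-* {a} {a'} {b} {b'} a≈ b≈ =
    trans (%-distribˡ-* a b q)
          (trans (cong₂ (λ x y → (x * y) % q) a≈ b≈) (sym (%-distribˡ-* a' b' q)))

  ≈-value : ∀ {a b} → a ≈ b → b < q → a % q ≡ b
  ≈-value a≈b b<q = trans a≈b (m<n⇒m%n≡m b<q)

  -- Adding the representative a + (q - (x mod q)) of "a - x" to x gives a.
  add-complement : ∀ x a → x + (a + (q ∸ x % q)) ≈ a
  add-complement x a = begin
    x + (a + (q ∸ x % q))       ≈⟨ ≈-+ (m%n%n≡m%n x q) refl ⟨
    x % q + (a + (q ∸ x % q))  ≡⟨ swap (x % q) a (q ∸ x % q) ⟩
    a + (x % q + (q ∸ x % q))  ≡⟨ cong (a +_) (m+[n∸m]≡n (m%n≤n x q)) ⟩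
    a + q                       ≈⟨ [m+n]%n≡m%n a q ⟩
    a                           ∎
    where
    open ≈-Reasoning
    swap : ∀ r a z → r + (a + z) ≡ a + (r + z)
    swap = solve-∀

  gcd-nonZero : ∀ A → NonZero (gcd A q)
  gcd-nonZero A = ≢-nonZero (gcd[m,n]≢0 A q (inj₂ (≢-nonZero⁻¹ q)))

  -- The cofactor q / gcd(A, q): the order of A in the additive group ℤ/q.
  cofactor : ℕ → ℕ
  cofactor A = _/_ q (gcd A q) {{gcd-nonZero A}}

  cofactor-nonZero : ∀ A → NonZero (cofactor A)
  cofactor-nonZero A = >-nonZero (m≥n⇒m/n>0 {{gcd-nonZero A}} (∣⇒≤ (gcd[m,n]∣n A q)))

  cofactor*gcd : ∀ A → cofactor A * gcd A q ≡ q
  cofactor*gcd A = m/n*n≡m {{gcd-nonZero A}} (gcd[m,n]∣n A q)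

  cofactor≤q : ∀ A → cofactor A ≤ q
  cofactor≤q A = m/n≤m q (gcd A q) {{gcd-nonZero A}}

  bezout : ∀ A → Σ ℕ λ x → A * x ≈ gcd A q
  bezout A with Bézout.identity (gcd-GCD A q)
  ... | Bézout.+- x y d+yq≡xA = x , (begin
    A * x      ≡⟨ trans (*-comm A x) (sym d+yq≡xA) ⟩
    d + y * q  ≈⟨ [m+kn]%n≡m%n d y q ⟩
    d          ∎)
    where
    open ≈-Reasoning
    d = gcd A q
  ... | Bézout.-+ x y d+xA≡yq = x * (q ∸ 1) , (begin
    A * (x * (q ∸ 1))               ≈⟨ [m+kn]%n≡m%n (A * (x * (q ∸ 1))) y q ⟨
    A * (x * (q ∸ 1)) + y * q       ≡⟨ cong (A * (x * (q ∸ 1)) +_) (sym d+xA≡yq) ⟩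
    A * (x * (q ∸ 1)) + (d + x * A) ≡⟨ negate A x (q ∸ 1) d ⟩
    d + A * x * (1 + (q ∸ 1))       ≡⟨ cong (λ z → d + A * x * z) (m+[n∸m]≡n (>-nonZero⁻¹ q)) ⟩
    d + A * x * q                   ≈⟨ [m+kn]%n≡m%n d (A * x) q ⟩
    d                               ∎)
    where
    open ≈-Reasoning
    d = gcd A q
    -- Multiplying by q - 1 negates modulo q.
    negate : ∀ A x r d → A * (x * r) + (d + x * A) ≡ d + A * x * (1 + r)
    negate = solve-∀

  multiples-reachable : ∀ A h → Σ ℕ λ e → e < cofactor A × A * e ≈ gcd A q * h
  multiples-reachable A h = e , m%n<n (x * h) Q , reaches
    where
    instance _ = cofactor-nonZero A
    g = gcd A q
    Q = cofactor A
    x = proj₁ (bezout A)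
    e = (x * h) % Q
    w = (x * h) / Q
    s = _∣_.quotient (gcd[m,n]∣m A q)
    AQ≡sq : A * Q ≡ s * q
    AQ≡sq = begin
      A * Q        ≡⟨ cong (_* Q) (_∣_.equality (gcd[m,n]∣m A q)) ⟩
      s * g * Q    ≡⟨ *-assoc s g Q ⟩
      s * (g * Q)  ≡⟨ cong (s *_) (trans (*-comm g Q) (cofactor*gcd A)) ⟩
      s * q        ∎
      where open ≡-Reasoning
    reaches : A * e ≈ g * h
    reaches = begin
      A * e                  ≈⟨ [m+kn]%n≡m%n (A * e) (w * s) q ⟨
      A * e + w * s * q      ≡⟨ cong (λ z → A * e + z) (trans (*-assoc w s q) (cong (w *_) (sym AQ≡sq))) ⟩
      A * e + w * (A * Q)    ≡⟨ distribute A e w Q ⟩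
      A * (e + w * Q)        ≡⟨ cong (A *_) (sym (m≡m%n+[m/n]*n (x * h) Q)) ⟩
      A * (x * h)            ≡⟨ *-assoc A x h ⟨
      A * x * h              ≈⟨ ≈-* (proj₂ (bezout A)) refl ⟩
      g * h                  ∎
      where
      open ≈-Reasoning
      distribute : ∀ A e w Q → A * e + w * (A * Q) ≡ A * (e + w * Q)
      distribute = solve-∀

  linear-solvable : ∀ j → gcd j q ≡ 1 → ∀ D → Σ ℕ λ σ → σ < q × σ * j ≈ D
  linear-solvable j coprime D =
    σ , <-≤-trans (proj₁ (proj₂ reachable)) (cofactor≤q j) , σj≈D
    where
    reachable = multiples-reachable j D
    σ = proj₁ reachable
    open ≈-Reasoning
    σj≈D : σ * j ≈ D
    σj≈D = begin
      σ * j        ≡⟨ *-comm σ j ⟩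
      j * σ        ≈⟨ proj₂ (proj₂ reachable) ⟩
      gcd j q * D  ≡⟨ cong (_* D) coprime ⟩
      1 * D        ≡⟨ *-identityˡ D ⟩
      D            ∎

small-coprime : ∀ {k q} → ((d : ℕ) → d ∣ q → d ≢ 1 → k < d) →
                ∀ {j} → 1 ≤ j → j ≤ k → gcd j q ≡ 1
small-coprime {k} {q} large {j} 1≤j j≤k with gcd j q ≟ 1
... | yes coprime = coprime
... | no  g≢1     = contradiction
  (≤-trans (∣⇒≤ {{>-nonZero 1≤j}} (gcd[m,n]∣m j q)) j≤k)
  (<⇒≱ (large (gcd j q) (gcd[m,n]∣n j q) g≢1))

cyclic-gap : ∀ k {i i'} → i < i' → i' < suc (2 * k) →
  Σ ℕ λ j → 1 ≤ j × j ≤ k ×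
    ((i + j) % suc (2 * k) ≡ i' ⊎ (i' + j) % suc (2 * k) ≡ i)
cyclic-gap k {i} {i'} i<i' i'<M with (i' ∸ i) ≤? k
... | yes δ≤k = i' ∸ i , m<n⇒0<n∸m i<i' , δ≤k , inj₁ forward
  where
  forward : (i + (i' ∸ i)) % suc (2 * k) ≡ i'
  forward = trans (cong (_% suc (2 * k)) (m+[n∸m]≡n (<⇒≤ i<i'))) (m<n⇒m%n≡m i'<M)
... | no δ≰k = M ∸ δ , m<n⇒0<n∸m δ<M , M∸δ≤k , inj₂ backward
  where
  M = suc (2 * k)
  δ = i' ∸ i
  δ<M : δ < M
  δ<M = ≤-<-trans (m∸n≤m i' i) i'<M
  M∸δ≤k : M ∸ δ ≤ k
  M∸δ≤k = subst (M ∸ δ ≤_) (trans (m+n∸m≡n k (k + 0)) (+-identityʳ k)) (∸-monoʳ-≤ M (≰⇒> δ≰k))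
  wraps : i' + (M ∸ δ) ≡ i + M
  wraps = begin
    i' + (M ∸ δ)       ≡⟨ cong (_+ (M ∸ δ)) (m+[n∸m]≡n (<⇒≤ i<i')) ⟨
    (i + δ) + (M ∸ δ)  ≡⟨ +-assoc i δ (M ∸ δ) ⟩
    i + (δ + (M ∸ δ))  ≡⟨ cong (i +_) (m+[n∸m]≡n (<⇒≤ δ<M)) ⟩
    i + M              ∎
    where open ≡-Reasoning
  backward : (i' + (M ∸ δ)) % M ≡ i
  backward = trans (cong (_% M) wraps)
                   (trans ([m+n]%n≡m%n i M) (m<n⇒m%n≡m (<-trans i<i' i'<M)))

module CrossBlocks (k q : ℕ) .{{_ : NonZero q}} where

  open Modular q

  M : ℕ
  M = suc (2 * k)

  g : ℕ → ℕ
  g σ = gcd (M * σ) q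

  Q : ℕ → ℕ
  Q σ = cofactor (M * σ)

  crossPiece : ℕ → ℕ → Seq
  crossPiece σ ρ = mkSeq (M * Q σ + k) (λ u → u % M + M * ((σ * u + ρ) % q))

  crossBlock : ℕ → Seq
  crossBlock σ = blocks (g σ) (crossPiece σ)

  cross : Seq
  cross = blocks q crossBlock

  window-start : ∀ σ {i a} → i < M → a < q →
    Σ ℕ λ ρ → ρ < g σ × Σ ℕ λ t → t < M * Q σ × t % M ≡ i × σ * t + ρ ≈ a
  window-start σ {i} {a} i<M a<q = ρ , m%n<n c (g σ) , t , t<MQ , t%M≡i , reaches
    where
    instance _ = gcd-nonZero (M * σ)
    c = a + (q ∸ (σ * i) % q)
    h = c / g σ
    ρ = c % g σ
    reachable = multiples-reachable (M * σ) h
    e = proj₁ reachable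
    t = i + M * e
    t<MQ : t < M * Q σ
    t<MQ = begin-strict
      i + M * e  <⟨ +-monoˡ-< (M * e) i<M ⟩
      M + M * e  ≡⟨ *-suc M e ⟨
      M * suc e  ≤⟨ *-monoʳ-≤ M (proj₁ (proj₂ reachable)) ⟩
      M * Q σ    ∎
      where open ≤-Reasoning
    t%M≡i : t % M ≡ i
    t%M≡i = trans (cong (λ z → (i + z) % M) (*-comm M e))
                  (trans ([m+kn]%n≡m%n i e M) (m<n⇒m%n≡m i<M))
    reaches : σ * t + ρ ≈ a
    reaches = begin
      σ * t + ρ                  ≡⟨ expand σ i M e ρ ⟩
      σ * i + M * σ * e + ρ      ≈⟨ ≈-+ (≈-+ {σ * i} refl (proj₂ (proj₂ reachable))) refl ⟩
      σ * i + g σ * h + ρ        ≡⟨ regroup (σ * i) (g σ) h ρ ⟩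
      σ * i + (ρ + h * g σ)      ≡⟨ cong (σ * i +_) (m≡m%n+[m/n]*n c (g σ)) ⟨
      σ * i + c                  ≈⟨ add-complement (σ * i) a ⟩
      a                          ∎
      where
      open ≈-Reasoning
      expand : ∀ σ i M e ρ → σ * (i + M * e) + ρ ≡ σ * i + M * σ * e + ρ
      expand = solve-∀
      regroup : ∀ x g h ρ → x + g * h + ρ ≡ x + (ρ + h * g)
      regroup = solve-∀

  covers-positions : ∀ {σ ρ t j} → σ < q → ρ < g σ → t < M * Q σ → j ≤ k →
                     Covers k cross (at (crossPiece σ ρ) t) (at (crossPiece σ ρ) (t + j))
  covers-positions {σ} {ρ} {t} {j} σ<q ρ<g t<MQ j≤k =
    covers-blocks q crossBlock σ<q (covers-blocks (g σ) (crossPiece σ) ρ<g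
      (t , t + j , <-≤-trans t<MQ (m≤m+n _ k) , +-mono-<-≤ t<MQ j≤k , refl , refl ,
       subst (_≤ k) (sym (∣m-m+n∣≡n t j)) j≤k))

  -- A shift j ≤ k that is a unit modulo q: the letters i + M·a and
  -- ((i + j) mod M) + M·b sit at positions t and t + j of a block whose slope σ
  -- solves σ·j ≡ b - a (mod q), with t given by window-start.
  covers-shift : ∀ {i j a b} → gcd j q ≡ 1 → j ≤ k → i < M → a < q → b < q →
                 Covers k cross (i + M * a) ((i + j) % M + M * b)
  covers-shift {i} {j} {a} {b} coprime j≤k i<M a<q b<q =
    subst₂ (Covers k cross)
      (cong₂ _+_ t%M≡i (cong (M *_) (≈-value reaches-a a<q)))
      (cong₂ _+_ shifted-residue (cong (M *_) (≈-value reaches-b b<q)))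
      (covers-positions σ<q ρ<g t<MQ j≤k)
    where
    solution = linear-solvable j coprime (b + (q ∸ a % q))
    σ = proj₁ solution
    σ<q = proj₁ (proj₂ solution)
    window = window-start σ i<M a<q
    ρ = proj₁ window
    ρ<g = proj₁ (proj₂ window)
    t = proj₁ (proj₂ (proj₂ window))
    t<MQ = proj₁ (proj₂ (proj₂ (proj₂ window)))
    t%M≡i = proj₁ (proj₂ (proj₂ (proj₂ (proj₂ window))))
    reaches-a = proj₂ (proj₂ (proj₂ (proj₂ (proj₂ window))))
    reaches-b : σ * (t + j) + ρ ≈ b
    reaches-b = begin
      σ * (t + j) + ρ              ≡⟨ expand σ t j ρ ⟩
      σ * t + ρ + σ * j            ≈⟨ ≈-+ reaches-a (proj₂ (proj₂ solution)) ⟩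
      a + (b + (q ∸ a % q))        ≈⟨ add-complement a b ⟩
      b                            ∎
      where
      open ≈-Reasoning
      expand : ∀ σ t j ρ → σ * (t + j) + ρ ≡ σ * t + ρ + σ * j
      expand = solve-∀
    shifted-residue : (t + j) % M ≡ (i + j) % M
    shifted-residue = Modular.≈-+ M {t} {i} {j} {j} (trans t%M≡i (sym (m<n⇒m%n≡m i<M))) refl

  covers-cross< : ((d : ℕ) → d ∣ q → d ≢ 1 → k < d) →
                  ∀ {i i' a b} → i < i' → i' < M → a < q → b < q →
                  Covers k cross (i + M * a) (i' + M * b)
  covers-cross< large {i} {i'} {a} {b} i<i' i'<M a<q b<q with cyclic-gap k i<i' i'<M
  ... | j , 1≤j , j≤k , inj₁ i+j≡i' =
    subst (λ z → Covers k cross (i + M * a) (z + M * b)) i+j≡i'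
      (covers-shift (small-coprime large 1≤j j≤k) j≤k (<-trans i<i' i'<M) a<q b<q)
  ... | j , 1≤j , j≤k , inj₂ i'+j≡i =
    covers-sym (subst (λ z → Covers k cross (i' + M * b) (z + M * a)) i'+j≡i
      (covers-shift (small-coprime large 1≤j j≤k) j≤k i'<M b<q a<q))

  covers-cross : ((d : ℕ) → d ∣ q → d ≢ 1 → k < d) →
                 ∀ {i i' a b} → i < M → i' < M → i ≢ i' → a < q → b < q →
                 Covers k cross (i + M * a) (i' + M * b)
  covers-cross large {i} {i'} i<M i'<M i≢i' a<q b<q with <-cmp i i'
  ... | tri< i<i' _ _ = covers-cross< large i<i' i'<M a<q b<q
  ... | tri≈ _ i≡i' _ = contradiction i≡i' i≢i'
  ... | tri> _ _ i'<i = covers-sym (covers-cross< large i'<i i<M b<q a<q)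

  len-crossBlock : ∀ σ → len (crossBlock σ) ≡ M * q + k * g σ
  len-crossBlock σ = begin
    len (crossBlock σ)         ≡⟨ len-blocks (g σ) (crossPiece σ) (M * Q σ + k) (λ _ → refl) ⟩
    g σ * (M * Q σ + k)        ≡⟨ regroup (g σ) M (Q σ) k ⟩
    M * (Q σ * g σ) + k * g σ  ≡⟨ cong (λ z → M * z + k * g σ) (cofactor*gcd (M * σ)) ⟩
    M * q + k * g σ            ∎
    where
    open ≡-Reasoning
    regroup : ∀ g M Q k → g * (M * Q + k) ≡ M * (Q * g) + k * g
    regroup = solve-∀

  len-cross : len cross ≡ q * (M * q) + k * sum (map g (upTo q))
  len-cross =
    trans (len-concat crossBlock (λ σ → M * q + k * g σ) (upTo q) len-crossBlock)
          (trans (sum-affine (M * q) k g (upTo q))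
                 (cong (λ z → z * (M * q) + k * sum (map g (upTo q))) (length-upTo q)))

module Construction (n k q : ℕ) .{{_ : NonZero q}} (ys : List (Fin (n / suc (2 * k)))) where

  open CrossBlocks k q public

  N : ℕ
  N = q * M

  group : ℕ → Seq
  group i = relabel (λ a → i + M * (a % q)) (fromList ys)

  groups : Seq
  groups = blocks M group

  outer : Seq
  outer = blocks (n ∸ N) (λ r → blocks n (pair (N + r)))

  sequence : Seq
  sequence = groups ++ˢ (cross ++ˢ outer)

  covers-groups : q ≤ n / M → IsKRadius k (n / M) ys →
                  ∀ {i a b} → i < M → a < q → b < q → Covers k groups (i + M * a) (i + M * b)
  covers-groups q≤m radius {i} {a} {b} i<M a<q b<q =
    covers-blocks M group i<M
      (subst₂ (Covers k (group i)) (relabel-level a<q) (relabel-level b<q)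
        (covers-relabel (λ c → i + M * (c % q))
          (covers-fromList ys radius (fromℕ< (<-≤-trans a<q q≤m)) (fromℕ< (<-≤-trans b<q q≤m)))))
    where
    relabel-level : ∀ {c} (c<q : c < q) →
                    i + M * (toℕ (fromℕ< (<-≤-trans c<q q≤m)) % q) ≡ i + M * c
    relabel-level c<q = cong (λ z → i + M * z)
      (trans (cong (_% q) (toℕ-fromℕ< _)) (m<n⇒m%n≡m c<q))

  covers-outer : 1 ≤ k → ∀ {x y} → N ≤ x → x < n → y < n → Covers k outer x y
  covers-outer 1≤k {x} {y} N≤x x<n y<n =
    covers-blocks (n ∸ N) (λ r → blocks n (pair (N + r))) (∸-monoˡ-< x<n N≤x)
      (subst (λ z → Covers k (blocks n (pair z)) x y) (sym (m+[n∸m]≡n N≤x))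
        (covers-blocks n (pair x) y<n (covers-pair x y 1≤k)))

  decompose : ∀ x → x % M + M * (x / M) ≡ x
  decompose x = sym (trans (m≡m%n+[m/n]*n x M) (cong (x % M +_) (*-comm (x / M) M)))

  covers-sequence : 1 ≤ k → ((d : ℕ) → d ∣ q → d ≢ 1 → k < d) → q ≤ n / M →
                    IsKRadius k (n / M) ys →
                    ∀ {x y} → x < n → y < n → Covers k sequence x y
  covers-sequence 1≤k large q≤m radius {x} {y} x<n y<n with x <? N | y <? N
  ... | no x≮N | _ =
    covers-++ʳ groups (covers-++ʳ cross (covers-outer 1≤k (≮⇒≥ x≮N) x<n y<n))
  ... | yes _ | no y≮N =
    covers-sym (covers-++ʳ groups (covers-++ʳ cross (covers-outer 1≤k (≮⇒≥ y≮N) y<n x<n)))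
  ... | yes x<N | yes y<N =
    subst₂ (Covers k sequence) (decompose x) (decompose y)
      (low (m%n<n x M) (m%n<n y M) (m<n*o⇒m/o<n x<N) (m<n*o⇒m/o<n y<N))
    where
    low : ∀ {i i' a b} → i < M → i' < M → a < q → b < q →
          Covers k sequence (i + M * a) (i' + M * b)
    low {i} {i'} i<M i'<M a<q b<q with i ≟ i'
    ... | yes refl = covers-++ˡ (cross ++ˢ outer) (covers-groups q≤m radius i<M a<q b<q)
    ... | no i≢i'  = covers-++ʳ groups (covers-++ˡ outer
                       (covers-cross large i<M i'<M i≢i' a<q b<q))

  len-sequence : len sequence ≡
    M * length ys + ((q * (M * q) + k * sum (map g (upTo q))) + (n ∸ N) * (n * 2))
  len-sequence = cong₂ _+_
    (len-blocks M group (length ys) (λ _ → refl))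
    (cong₂ _+_ len-cross
      (len-blocks (n ∸ N) _ (n * 2) (λ r → len-blocks n (pair (N + r)) 2 (λ _ → refl))))

-- M times the length of the construction, in the shape of the bound.
scaled-length : ∀ M L q k S D n →
  M * (L + ((q * (M * q) + k * S) + D * (n * 2))) ≡
  M * L + M * (2 * n * D) + (q * M) * (q * M) + M * (k * S)
scaled-length = solve-∀

lemma5 : (n k q : ℕ) → 1 ≤ k → k ≤ n → 1 ≤ q → q * (suc (2 * k)) ≤ n →
         ((d : ℕ) → d ∣ q → d ≢ 1 → k < d) →
         (F Fm : ℕ) → IsFk k n F → IsFk k (n / (suc (2 * k))) Fm →
         (suc (2 * k)) * F ≤
           (suc (2 * k)) * ((suc (2 * k)) * Fm)
           + (suc (2 * k)) * (2 * n * (n ∸ q * (suc (2 * k))))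
           + n * n
           + (suc (2 * k)) * (k * sum (map (λ d → gcd ((suc (2 * k)) * d) q) (upTo q)))
lemma5 n k q 1≤k k≤n 1≤q N≤n large F Fm (_ , minimal) ((ys , radius , ys-length) , _) = begin
  M * F
    ≤⟨ *-monoʳ-≤ M F≤len ⟩
  M * len sequence
    ≡⟨ cong (M *_) (trans len-sequence (cong (λ L → M * L + rest) ys-length)) ⟩
  M * (M * Fm + rest)
    ≡⟨ scaled-length M (M * Fm) q k S D n ⟩
  M * (M * Fm) + M * (2 * n * D) + N * N + M * (k * S)
    ≤⟨ +-monoˡ-≤ (M * (k * S)) (+-monoʳ-≤ (M * (M * Fm) + M * (2 * n * D)) (*-mono-≤ N≤n N≤n)) ⟩
  M * (M * Fm) + M * (2 * n * D) + n * n + M * (k * S) ∎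
  where
  instance
    q-nonZero : NonZero q
    q-nonZero = >-nonZero 1≤q
    n-nonZero : NonZero n
    n-nonZero = >-nonZero (≤-trans 1≤k k≤n)
  open Construction n k q ys
  open ToWord n
  open ≤-Reasoning
  S = sum (map g (upTo q))
  D = n ∸ N
  rest = (q * (M * q) + k * S) + D * (n * 2)
  q≤m : q ≤ n / M
  q≤m = subst (_≤ n / M) (m*n/n≡m q M) (/-monoˡ-≤ M N≤n)
  F≤len : F ≤ len sequence
  F≤len = subst (F ≤_) (length-toWord sequence)
    (minimal (toWord sequence) (toWord-isKRadius k sequence
      (λ a b → covers-sequence 1≤k large q≤m radius (toℕ<n a) (toℕ<n b))))
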